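{- Let $1\le b\le n$ be integers and let $f(X)=\mathbb{1}\{|X|\ge b\}$ for $X\in\{0,1\}^n$. Then $f$ has a $2$-anchor NN representation with resolution $O(1)$.
   Context: $|X|$ is the number of ones in $X$; $d$ is Euclidean distance. An NN representation of $f$ is a pair of disjoint finite sets $P,N\subset\mathbb{R}^n$ (anchors) such that for every $X$ with $f(X)=1$ there is $p\in P$ with $d(X,p)<d(X,q)$ for all $q\in N$, and for every $X$ with $f(X)=0$ there is $q\in N$ with $d(X,q)<d(X,p)$ for all $p\in P$. The resolution of a rational $a/b$ ($a,b\in\mathbb{Z}$ coprime, $b\ne0$) is $RES(a/b)=\lceil\max\{\log_2|a+1|,\log_2|b+1|\}\rceil$; the resolution of an NN representation is the maximum resolution over all entries of all anchors. -}

module Defs where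

open import Data.Nat as ℕ using (ℕ; _≤_; _⊔_)
open import Data.Nat.Logarithm using (⌈log₂_⌉)
open import Data.Integer as ℤ using (ℤ; ∣_∣)
open import Data.Rational as ℚ using (ℚ; ↥_; ↧ₙ_; 0ℚ; 1ℚ; _<_)
open import Data.Bool using (Bool; true; false; if_then_else_)
open import Data.Vec using (Vec; []; _∷_; map; zipWith; foldr; count)
open import Data.List using (List)
open import Data.List.Membership.Propositional using (_∈_; _∉_)
open import Data.List.Relation.Unary.All using (All)
open import Data.Product using (Σ; _×_; ∃-syntax)
open import Relation.Binary.PropositionalEquality using (_≡_)
open import Relation.Nullary.Decidable using (⌊_⌋)
open import Data.Bool.Properties using (T?)

weight : ∀ {n} → Vec Bool n → ℕ
weight = count T?

threshold : ∀ {n} → ℕ → Vec Bool n → Bool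
threshold b X = ⌊ b ℕ.≤? weight X ⌋

embed : ∀ {n} → Vec Bool n → Vec ℚ n
embed = map (λ x → if x then 1ℚ else 0ℚ)

-- squared Euclidean distance (comparisons of d are equivalent to comparisons of d²)
sqDist : ∀ {n} → Vec ℚ n → Vec ℚ n → ℚ
sqDist u v = foldr _ ℚ._+_ 0ℚ (zipWith (λ a c → (a ℚ.- c) ℚ.* (a ℚ.- c)) u v)

NNRep : ∀ {n} → (Vec Bool n → Bool) → List (Vec ℚ n) → List (Vec ℚ n) → Set
NNRep f P N =
  (∀ {p} → p ∈ P → p ∉ N) ×
  (∀ X → (f X ≡ true → ∃[ p ] (p ∈ P × (∀ {q} → q ∈ N → sqDist (embed X) p < sqDist (embed X) q)))
       × (f X ≡ false → ∃[ q ] (q ∈ N × (∀ {p} → p ∈ P → sqDist (embed X) q < sqDist (embed X) p))))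

-- RES(a/b) = ⌈max(log₂|a+1|, log₂|b+1|)⌉ with a/b in lowest terms, b > 0
-- (⌈log₂ 0⌉ = 0 in the library, harmless since the b-term is ≥ 1)
RES : ℚ → ℕ
RES q = ⌈log₂ ∣ (↥ q) ℤ.+ ℤ.+ 1 ∣ ⌉ ⊔ ⌈log₂ (↧ₙ q ℕ.+ 1) ⌉

AnchorRes≤ : ∀ {n} → ℕ → Vec ℚ n → Set
AnchorRes≤ C v = Data.Vec.Relation.Unary.All.All (λ x → RES x ≤ C) v
  where import Data.Vec.Relation.Unary.All

{-# OPTIONS --safe #-}
-- Put c = (½, Y) with Y ∈ {0,1}^(n-1) of weight b - 1, so that Σ c = b - ½, and take the two
-- anchors p = c + ¼ and q = c - ¼, whose entries lie in {-¼, ¼, ¾, 5/4}. Coordinatewise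
-- (x - c + ¼)² - (x - c - ¼)² = x - c, so d(X,q)² - d(X,p)² = |X| - Σ c = |X| - b + ½,
-- which is positive exactly when |X| ≥ b.
module Submission where

open import Defs
open import Data.Nat as ℕ using (ℕ; zero; suc; z≤n; s≤s; _≤_; _+_)
import Data.Nat.Properties as ℕ
open import Data.Integer using (+_)
open import Data.Rational as ℚ using (ℚ; 0ℚ; 1ℚ; ½; -_; _-_)
import Data.Rational.Properties as ℚ
open import Data.Rational.Solver using (module +-*-Solver)
open import Data.Bool using (Bool; true; false; T)
open import Data.Vec using (Vec; []; _∷_; map; foldr; head)
import Data.Vec.Relation.Unary.All as VecAll
open import Data.Vec.Relation.Unary.All.Properties using (map⁺)
open import Data.List using ([_]; length)
open import Data.List.Relation.Unary.All as All using (All)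
open import Data.List.Relation.Unary.Any using (here)
open import Data.List.Membership.Propositional using (_∈_; _∉_)
open import Data.Product using (_×_; _,_; ∃-syntax)
open import Relation.Nullary using (yes; no)
open import Relation.Binary.PropositionalEquality using (_≡_; _≢_; refl; sym; trans; cong; subst)
open +-*-Solver

¼ : ℚ
¼ = + 1 ℚ./ 4

fromℕ : ℕ → ℚ
fromℕ zero    = 0ℚ
fromℕ (suc n) = 1ℚ ℚ.+ fromℕ n

fromℕ-+ : ∀ m n → fromℕ (m + n) ≡ fromℕ m ℚ.+ fromℕ n
fromℕ-+ zero    n = sym (ℚ.+-identityˡ (fromℕ n))
fromℕ-+ (suc m) n rewrite fromℕ-+ m n = sym (ℚ.+-assoc 1ℚ (fromℕ m) (fromℕ n))

fromℕ-nonNeg : ∀ n → 0ℚ ℚ.≤ fromℕ n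
fromℕ-nonNeg zero    = ℚ.≤-refl
fromℕ-nonNeg (suc n) = ℚ.+-mono-≤ (ℚ.<⇒≤ (ℚ.positive⁻¹ 1ℚ)) (fromℕ-nonNeg n)

sumℚ : ∀ {n} → Vec ℚ n → ℚ
sumℚ = foldr _ ℚ._+_ 0ℚ

sumℚ-embed : ∀ {n} (X : Vec Bool n) → sumℚ (embed X) ≡ fromℕ (weight X)
sumℚ-embed []          = refl
sumℚ-embed (true ∷ X)  = cong (1ℚ ℚ.+_) (sumℚ-embed X)
sumℚ-embed (false ∷ X) = trans (ℚ.+-identityˡ _) (sumℚ-embed X)

sqDist-shift : ∀ {n} (u c : Vec ℚ n) →
  sqDist u (map (_- ¼) c) ≡ sqDist u (map (ℚ._+ ¼) c) ℚ.+ (sumℚ u - sumℚ c)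
sqDist-shift []      []      = refl
sqDist-shift (x ∷ u) (a ∷ c) rewrite sqDist-shift u c =
  solve 5 (λ x a D U C →
      (x :- (a :- con ¼)) :* (x :- (a :- con ¼)) :+ (D :+ (U :- C))
   := (x :- (a :+ con ¼)) :* (x :- (a :+ con ¼)) :+ D :+ ((x :+ U) :- (a :+ C)))
    refl x a (sqDist u (map (ℚ._+ ¼) c)) (sumℚ u) (sumℚ c)

0<½+fromℕ : ∀ j → 0ℚ ℚ.< ½ ℚ.+ fromℕ j
0<½+fromℕ j = ℚ.+-mono-<-≤ (ℚ.positive⁻¹ ½) (fromℕ-nonNeg j)

margin-pos : ∀ {b w} → b ≤ w → 0ℚ ℚ.< fromℕ w - (fromℕ b - ½)
margin-pos {b} b≤w with ℕ.m≤n⇒∃[o]m+o≡n b≤w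
... | j , refl rewrite fromℕ-+ b j =
  subst (0ℚ ℚ.<_)
    (solve 2 (λ B J → con ½ :+ J := (B :+ J) :- (B :- con ½)) refl (fromℕ b) (fromℕ j))
    (0<½+fromℕ j)

margin-neg : ∀ {b w} → w ℕ.< b → fromℕ w - (fromℕ b - ½) ℚ.< 0ℚ
margin-neg {w = w} w<b with ℕ.m≤n⇒∃[o]m+o≡n w<b
... | j , refl rewrite fromℕ-+ w j =
  subst (ℚ._< 0ℚ)
    (solve 2 (λ W J → :- (con ½ :+ J) := W :- ((con 1ℚ :+ (W :+ J)) :- con ½)) refl (fromℕ w) (fromℕ j))
    (ℚ.neg-antimono-< (0<½+fromℕ j))

p<p+q : ∀ p {q} → 0ℚ ℚ.< q → p ℚ.< p ℚ.+ q
p<p+q p 0<q = subst (ℚ._< p ℚ.+ _) (ℚ.+-identityʳ p) (ℚ.+-monoʳ-< p 0<q)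

p+q<p : ∀ p {q} → q ℚ.< 0ℚ → p ℚ.+ q ℚ.< p
p+q<p p q<0 = subst (p ℚ.+ _ ℚ.<_) (ℚ.+-identityʳ p) (ℚ.+-monoʳ-< p q<0)

shift-¼-injective : ∀ {a} → a ℚ.+ ¼ ≢ a - ¼
shift-¼-injective {a} eq = ℚ.<-irrefl (sym eq) (ℚ.+-monoʳ-< a (ℚ.neg<pos (- ¼) ¼))

threshold-NNRep : ∀ {n} b (c : Vec ℚ (suc n)) → sumℚ c ≡ fromℕ b - ½ →
  NNRep (threshold b) [ map (ℚ._+ ¼) c ] [ map (_- ¼) c ]
threshold-NNRep b c@(a ∷ _) Σc≡b-½ = disjoint , classify
  where
  p q : Vec ℚ _
  p = map (ℚ._+ ¼) c
  q = map (_- ¼) c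

  disjoint : ∀ {x} → x ∈ [ p ] → x ∉ [ q ]
  disjoint (here refl) (here p≡q) = shift-¼-injective {a} (cong head p≡q)

  gap : ∀ X → sqDist (embed X) q ≡ sqDist (embed X) p ℚ.+ (fromℕ (weight X) - (fromℕ b - ½))
  gap X rewrite sym (sumℚ-embed X) | sym Σc≡b-½ = sqDist-shift (embed X) c

  classify : ∀ X →
    (threshold b X ≡ true → ∃[ x ] (x ∈ [ p ] × (∀ {y} → y ∈ [ q ] → sqDist (embed X) x ℚ.< sqDist (embed X) y)))
    × (threshold b X ≡ false → ∃[ y ] (y ∈ [ q ] × (∀ {x} → x ∈ [ p ] → sqDist (embed X) y ℚ.< sqDist (embed X) x)))
  classify X with b ℕ.≤? weight X
  ... | yes b≤w = (λ _ → p , here refl , λ { (here refl) → p-closer }) , λ ()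
    where
    p-closer : sqDist (embed X) p ℚ.< sqDist (embed X) q
    p-closer rewrite gap X = p<p+q _ (margin-pos b≤w)
  ... | no b≰w = (λ ()) , λ _ → q , here refl , λ { (here refl) → q-closer }
    where
    q-closer : sqDist (embed X) q ℚ.< sqDist (embed X) p
    q-closer rewrite gap X = p+q<p _ (margin-neg (ℕ.≰⇒> b≰w))

∃-weight : ∀ {k m} → k ≤ m → ∃[ Y ] (weight {m} Y ≡ k)
∃-weight {m = zero}  z≤n = [] , refl
∃-weight {m = suc m} z≤n with ∃-weight {m = m} z≤n
... | Y , wY≡0 = false ∷ Y , wY≡0
∃-weight (s≤s k≤m) with ∃-weight k≤m
... | Y , wY≡k = true ∷ Y , cong suc wY≡k

map-embed-res : ∀ {C m} (f : ℚ → ℚ) → RES (f 0ℚ) ≤ C → RES (f 1ℚ) ≤ C →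
  (Y : Vec Bool m) → AnchorRes≤ C (map f (embed Y))
map-embed-res f res₀ res₁ Y = map⁺ (map⁺ (VecAll.universal (λ { true → res₁ ; false → res₀ }) Y))

RES-≤ᵇ⇒≤ : ∀ {C} x → T (RES x ℕ.≤ᵇ C) → RES x ≤ C
RES-≤ᵇ⇒≤ {C} x = ℕ.≤ᵇ⇒≤ (RES x) C

centred-shift-res : ∀ {C m} (f : ℚ → ℚ) (Y : Vec Bool m) →
  T (RES (f ½) ℕ.≤ᵇ C) → T (RES (f 0ℚ) ℕ.≤ᵇ C) → T (RES (f 1ℚ) ℕ.≤ᵇ C) →
  AnchorRes≤ C (map f (½ ∷ embed Y))
centred-shift-res f Y r½ r₀ r₁ =
  RES-≤ᵇ⇒≤ (f ½) r½ VecAll.∷ map-embed-res f (RES-≤ᵇ⇒≤ (f 0ℚ) r₀) (RES-≤ᵇ⇒≤ (f 1ℚ) r₁) Y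

sumℚ-centred : ∀ {m} (Y : Vec Bool m) → sumℚ (½ ∷ embed Y) ≡ fromℕ (suc (weight Y)) - ½
sumℚ-centred Y rewrite sumℚ-embed Y =
  solve 1 (λ K → con ½ :+ K := (con 1ℚ :+ K) :- con ½) refl (fromℕ (weight Y))

corollary2 : ∃[ C ] (∀ n b → 1 ≤ b → b ≤ n →
               ∃[ P ] ∃[ N ] (length P + length N ≡ 2 × NNRep (threshold {n} b) P N
                 × All (AnchorRes≤ C) P × All (AnchorRes≤ C) N))
corollary2 = 3 , representation
  where
  representation : ∀ n b → 1 ≤ b → b ≤ n →
    ∃[ P ] ∃[ N ] (length P + length N ≡ 2 × NNRep (threshold {n} b) P N
      × All (AnchorRes≤ 3) P × All (AnchorRes≤ 3) N)
  representation (suc m) (suc k) _ (s≤s k≤m) with ∃-weight k≤m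
  ... | Y , refl =
    [ map (ℚ._+ ¼) (½ ∷ embed Y) ] , [ map (_- ¼) (½ ∷ embed Y) ] , refl ,
    threshold-NNRep (suc k) (½ ∷ embed Y) (sumℚ-centred Y) ,
    centred-shift-res (ℚ._+ ¼) Y _ _ _ All.∷ All.[] ,
    centred-shift-res (_- ¼) Y _ _ _ All.∷ All.[]
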